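{- In LLFP (defined in the context), if a judgement $\Gamma\vdash_\Sigma\mathcal{U}^{\mathcal{P}}_{N,\sigma}[M]:\tau$ is derivable, then $\mathcal{P}(\Gamma\vdash_\Sigma N:\sigma)$ holds.
   Context: LLFP (Lax Logical Framework) is parametrized by a set of predicates $\mathcal{P}$ on typing judgements $\Gamma \vdash_\Sigma N:\sigma$. Pseudo-syntax: signatures $\Sigma ::= \emptyset \mid \Sigma, a:K \mid \Sigma, c:\sigma$; contexts $\Gamma ::= \emptyset \mid \Gamma, x:\sigma$; kinds $K ::= \mathrm{Type} \mid \Pi x{:}\sigma.K$; families $\sigma,\tau,\rho ::= a \mid \Pi x{:}\sigma.\tau \mid \sigma N \mid \mathcal{L}^{\mathcal{P}}_{N,\sigma}[\rho]$; objects $M,N ::= c \mid x \mid \lambda x{:}\sigma.M \mid M N \mid \mathcal{L}^{\mathcal{P}}_{N,\sigma}[M] \mid \mathcal{U}^{\mathcal{P}}_{N,\sigma}[M]$. One-step $\beta\mathcal{L}$-reduction $\to_{\beta\mathcal{L}}$ is the closure under all constructors of $(\lambda x{:}\sigma.M)N \to M[N/x]$ and $\mathcal{U}^{\mathcal{P}}_{N,\sigma}[\mathcal{L}^{\mathcal{P}}_{N,\sigma}[M]] \to M$; $=_{\beta\mathcal{L}}$ is its reflexive, symmetric, transitive closure. Judgements: $\Sigma\ \mathrm{sig}$, $\vdash_\Sigma \Gamma$, $\Gamma\vdash_\Sigma K$, $\Gamma\vdash_\Sigma \sigma:K$, $\Gamma\vdash_\Sigma M:\sigma$, derived by the rules: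 Signatures: $\emptyset\ \mathrm{sig}$; from $\vdash_\Sigma K$ and $a\notin\mathrm{Dom}(\Sigma)$ infer $\Sigma,a:K\ \mathrm{sig}$; from $\vdash_\Sigma\sigma:\mathrm{Type}$ and $c\notin\mathrm{Dom}(\Sigma)$ infer $\Sigma,c:\sigma\ \mathrm{sig}$. Contexts: from $\Sigma\ \mathrm{sig}$ infer $\vdash_\Sigma\emptyset$; from $\Gamma\vdash_\Sigma\sigma:\mathrm{Type}$ and $x\notin\mathrm{Dom}(\Gamma)$ infer $\vdash_\Sigma\Gamma,x:\sigma$. Kinds: from $\vdash_\Sigma\Gamma$ infer $\Gamma\vdash_\Sigma\mathrm{Type}$; from $\Gamma,x:\sigma\vdash_\Sigma K$ infer $\Gamma\vdash_\Sigma\Pi x{:}\sigma.K$. Families: from $\vdash_\Sigma\Gamma$, $a:K\in\Sigma$ infer $\Gamma\vdash_\Sigma a:K$; from $\Gamma,x:\sigma\vdash_\Sigma\tau:\mathrm{Type}$ infer $\Gamma\vdash_\Sigma\Pi x{:}\sigma.\tau:\mathrm{Type}$; from $\Gamma\vdash_\Sigma\sigma:\Pi x{:}\tau.K$ and $\Gamma\vdash_\Sigma N:\tau$ infer $\Gamma\vdash_\Sigma\sigma N:K[N/x]$; from $\Gamma\vdash_\Sigma\rho:\mathrm{Type}$ and $\Gamma\vdash_\Sigma N:\sigma$ infer $\Gamma\vdash_\Sigma\mathcal{L}^{\mathcal{P}}_{N,\sigma}[\rho]:\mathrm{Type}$; from $\Gamma\vdash_\Sigma\sigma:K$, $\Gamma\vdash_\Sigma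 K'$, $K=_{\beta\mathcal{L}}K'$ infer $\Gamma\vdash_\Sigma\sigma:K'$; (F-Guarded-Unlock) from $\Gamma,x:\tau\vdash_\Sigma\mathcal{L}^{\mathcal{P}}_{S,\sigma}[\rho]:\mathrm{Type}$, $\Gamma\vdash_\Sigma N:\mathcal{L}^{\mathcal{P}}_{S',\sigma'}[\tau]$, $\sigma=_{\beta\mathcal{L}}\sigma'$, $S=_{\beta\mathcal{L}}S'$ infer $\Gamma\vdash_\Sigma\mathcal{L}^{\mathcal{P}}_{S,\sigma}[\rho[\mathcal{U}^{\mathcal{P}}_{S',\sigma'}[N]/x]]:\mathrm{Type}$. Objects: from $\vdash_\Sigma\Gamma$, $c:\sigma\in\Sigma$ infer $\Gamma\vdash_\Sigma c:\sigma$; from $\vdash_\Sigma\Gamma$, $x:\sigma\in\Gamma$ infer $\Gamma\vdash_\Sigma x:\sigma$; from $\Gamma,x:\sigma\vdash_\Sigma M:\tau$ infer $\Gamma\vdash_\Sigma\lambda x{:}\sigma.M:\Pi x{:}\sigma.\tau$; from $\Gamma\vdash_\Sigma M:\Pi x{:}\sigma.\tau$ and $\Gamma\vdash_\Sigma N:\sigma$ infer $\Gamma\vdash_\Sigma MN:\tau[N/x]$; from $\Gamma\vdash_\Sigma M:\sigma$, $\Gamma\vdash_\Sigma\tau:\mathrm{Type}$, $\sigma=_{\beta\mathcal{L}}\tau$ infer $\Gamma\vdash_\Sigma M:\tau$; (O-Lock) from $\Gamma\vdash_\Sigma M:\rho$ and $\Gamma\vdash_\Sigma N:\sigma$ infer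 $\Gamma\vdash_\Sigma\mathcal{L}^{\mathcal{P}}_{N,\sigma}[M]:\mathcal{L}^{\mathcal{P}}_{N,\sigma}[\rho]$; (O-Top-Unlock) from $\Gamma\vdash_\Sigma M:\mathcal{L}^{\mathcal{P}}_{N,\sigma}[\rho]$ and the (externally decided) fact that $\mathcal{P}(\Gamma\vdash_\Sigma N:\sigma)$ holds, infer $\Gamma\vdash_\Sigma\mathcal{U}^{\mathcal{P}}_{N,\sigma}[M]:\rho$; (O-Guarded-Unlock) from $\Gamma,x:\tau\vdash_\Sigma\mathcal{L}^{\mathcal{P}}_{S,\sigma}[M]:\mathcal{L}^{\mathcal{P}}_{S,\sigma}[\rho]$, $\Gamma\vdash_\Sigma N:\mathcal{L}^{\mathcal{P}}_{S',\sigma'}[\tau]$, $\sigma=_{\beta\mathcal{L}}\sigma'$, $S=_{\beta\mathcal{L}}S'$ infer $\Gamma\vdash_\Sigma\mathcal{L}^{\mathcal{P}}_{S,\sigma}[M[\mathcal{U}^{\mathcal{P}}_{S',\sigma'}[N]/x]]:\mathcal{L}^{\mathcal{P}}_{S,\sigma}[\rho[\mathcal{U}^{\mathcal{P}}_{S',\sigma'}[N]/x]]$. -}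

module Defs where

open import Data.Nat using (ℕ; zero; suc)
open import Data.List using (List; []; _∷_)
open import Data.List.Membership.Propositional using (_∈_)
open import Relation.Nullary using (¬_)
open import Relation.Binary.Construct.Closure.Equivalence using (EqClosure)

-- Variables are de Bruijn indices (ℕ); constants of the signature are
-- names (ℕ).  L is the index set of the family 𝒫 of predicates: every
-- lock / unlock carries the label p : L of "its" predicate 𝒫 p.

mutual
  data Kind (L : Set) : Set where
    Type : Kind L
    ΠK   : Fam L → Kind L → Kind L            -- Π x:σ. K   (binds 0 in K)

  data Fam (L : Set) : Set where
    fconst : ℕ → Fam L
    Πf     : Fam L → Fam L → Fam L            -- Π x:σ. τ   (binds 0 in τ)
    fapp   : Fam L → Obj L → Fam L
    lockF  : L → Obj L → Fam L → Fam L → Fam L -- 𝓛^p_{N,σ}[ρ]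

  data Obj (L : Set) : Set where
    oconst : ℕ → Obj L
    var    : ℕ → Obj L
    lam    : Fam L → Obj L → Obj L            -- λ x:σ. M   (binds 0 in M)
    oapp   : Obj L → Obj L → Obj L
    lockO  : L → Obj L → Fam L → Obj L → Obj L -- 𝓛^p_{N,σ}[M]
    unlock : L → Obj L → Fam L → Obj L → Obj L -- 𝓤^p_{N,σ}[M]

liftR : (ℕ → ℕ) → ℕ → ℕ
liftR r zero    = zero
liftR r (suc i) = suc (r i)

mutual
  renK : {L : Set} → (ℕ → ℕ) → Kind L → Kind L
  renK r Type       = Type
  renK r (ΠK σ K)   = ΠK (renF r σ) (renK (liftR r) K)

  renF : {L : Set} → (ℕ → ℕ) → Fam L → Fam L
  renF r (fconst a)      = fconst a
  renF r (Πf σ τ)        = Πf (renF r σ) (renF (liftR r) τ)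
  renF r (fapp σ N)      = fapp (renF r σ) (renO r N)
  renF r (lockF p N σ ρ) = lockF p (renO r N) (renF r σ) (renF r ρ)

  renO : {L : Set} → (ℕ → ℕ) → Obj L → Obj L
  renO r (oconst c)       = oconst c
  renO r (var i)          = var (r i)
  renO r (lam σ M)        = lam (renF r σ) (renO (liftR r) M)
  renO r (oapp M N)       = oapp (renO r M) (renO r N)
  renO r (lockO p N σ M)  = lockO p (renO r N) (renF r σ) (renO r M)
  renO r (unlock p N σ M) = unlock p (renO r N) (renF r σ) (renO r M)

shiftF : {L : Set} → Fam L → Fam L
shiftF = renF suc

shiftO : {L : Set} → Obj L → Obj L
shiftO = renO suc

liftS : {L : Set} → (ℕ → Obj L) → ℕ → Obj L
liftS s zero    = var zero
liftS s (suc i) = shiftO (s i)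

mutual
  subK : {L : Set} → (ℕ → Obj L) → Kind L → Kind L
  subK s Type     = Type
  subK s (ΠK σ K) = ΠK (subF s σ) (subK (liftS s) K)

  subF : {L : Set} → (ℕ → Obj L) → Fam L → Fam L
  subF s (fconst a)      = fconst a
  subF s (Πf σ τ)        = Πf (subF s σ) (subF (liftS s) τ)
  subF s (fapp σ N)      = fapp (subF s σ) (subO s N)
  subF s (lockF p N σ ρ) = lockF p (subO s N) (subF s σ) (subF s ρ)

  subO : {L : Set} → (ℕ → Obj L) → Obj L → Obj L
  subO s (oconst c)       = oconst c
  subO s (var i)          = s i
  subO s (lam σ M)        = lam (subF s σ) (subO (liftS s) M)
  subO s (oapp M N)       = oapp (subO s M) (subO s N)
  subO s (lockO p N σ M)  = lockO p (subO s N) (subF s σ) (subO s M)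
  subO s (unlock p N σ M) = unlock p (subO s N) (subF s σ) (subO s M)

single : {L : Set} → Obj L → ℕ → Obj L
single N zero    = N
single N (suc i) = var i

_[_]K : {L : Set} → Kind L → Obj L → Kind L
K [ N ]K = subK (single N) K

_[_]F : {L : Set} → Fam L → Obj L → Fam L
σ [ N ]F = subF (single N) σ

_[_]O : {L : Set} → Obj L → Obj L → Obj L
M [ N ]O = subO (single N) M

mutual
  data _⟶K_ {L : Set} : Kind L → Kind L → Set where
    ΠK₁ : ∀ {σ σ' K} → σ ⟶F σ' → ΠK σ K ⟶K ΠK σ' K
    ΠK₂ : ∀ {σ K K'} → K ⟶K K' → ΠK σ K ⟶K ΠK σ K'

  data _⟶F_ {L : Set} : Fam L → Fam L → Set where
    Πf₁    : ∀ {σ σ' τ} → σ ⟶F σ' → Πf σ τ ⟶F Πf σ' τ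
    Πf₂    : ∀ {σ τ τ'} → τ ⟶F τ' → Πf σ τ ⟶F Πf σ τ'
    fapp₁  : ∀ {σ σ' N} → σ ⟶F σ' → fapp σ N ⟶F fapp σ' N
    fapp₂  : ∀ {σ N N'} → N ⟶O N' → fapp σ N ⟶F fapp σ N'
    lockF₁ : ∀ {p N N' σ ρ} → N ⟶O N' → lockF p N σ ρ ⟶F lockF p N' σ ρ
    lockF₂ : ∀ {p N σ σ' ρ} → σ ⟶F σ' → lockF p N σ ρ ⟶F lockF p N σ' ρ
    lockF₃ : ∀ {p N σ ρ ρ'} → ρ ⟶F ρ' → lockF p N σ ρ ⟶F lockF p N σ ρ'

  data _⟶O_ {L : Set} : Obj L → Obj L → Set where
    β       : ∀ {σ M N} → oapp (lam σ M) N ⟶O (M [ N ]O)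
    βL      : ∀ {p N σ M} → unlock p N σ (lockO p N σ M) ⟶O M
    lam₁    : ∀ {σ σ' M} → σ ⟶F σ' → lam σ M ⟶O lam σ' M
    lam₂    : ∀ {σ M M'} → M ⟶O M' → lam σ M ⟶O lam σ M'
    oapp₁   : ∀ {M M' N} → M ⟶O M' → oapp M N ⟶O oapp M' N
    oapp₂   : ∀ {M N N'} → N ⟶O N' → oapp M N ⟶O oapp M N'
    lockO₁  : ∀ {p N N' σ M} → N ⟶O N' → lockO p N σ M ⟶O lockO p N' σ M
    lockO₂  : ∀ {p N σ σ' M} → σ ⟶F σ' → lockO p N σ M ⟶O lockO p N σ' M
    lockO₃  : ∀ {p N σ M M'} → M ⟶O M' → lockO p N σ M ⟶O lockO p N σ M'
    unlock₁ : ∀ {p N N' σ M} → N ⟶O N' → unlock p N σ M ⟶O unlock p N' σ M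
    unlock₂ : ∀ {p N σ σ' M} → σ ⟶F σ' → unlock p N σ M ⟶O unlock p N σ' M
    unlock₃ : ∀ {p N σ M M'} → M ⟶O M' → unlock p N σ M ⟶O unlock p N σ M'

_=K_ : {L : Set} → Kind L → Kind L → Set
_=K_ = EqClosure _⟶K_

_=F_ : {L : Set} → Fam L → Fam L → Set
_=F_ = EqClosure _⟶F_

_=O_ : {L : Set} → Obj L → Obj L → Set
_=O_ = EqClosure _⟶O_

data Decl (L : Set) : Set where
  famDecl : ℕ → Kind L → Decl L
  objDecl : ℕ → Fam L → Decl L

-- Σ, d  is  d ∷ Σ
Sig : Set → Set
Sig L = List (Decl L)

dom : {L : Set} → Sig L → List ℕ
dom []                 = []
dom (famDecl a K ∷ Σ') = a ∷ dom Σ'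
dom (objDecl c σ ∷ Σ') = c ∷ dom Σ'

-- Γ, x:σ  is  σ ∷ Γ  (x is de Bruijn index 0)
Ctx : Set → Set
Ctx L = List (Fam L)

-- x : σ ∈ Γ (types are weakened to live in the whole context Γ)
data _∋_∶_ {L : Set} : Ctx L → ℕ → Fam L → Set where
  here  : ∀ {Γ σ} → (σ ∷ Γ) ∋ zero ∶ shiftF σ
  there : ∀ {Γ i σ τ} → Γ ∋ i ∶ σ → (τ ∷ Γ) ∋ suc i ∶ shiftF σ

-- Typing judgements of LLFP, parametrised by the family of predicates
--   𝒫 p Σ Γ N σ   meaning   𝒫_p(Γ ⊢_Σ N : σ)

Preds : Set → Set₁
Preds L = L → Sig L → Ctx L → Obj L → Fam L → Set

mutual
  data SigOK {L : Set} (𝒫 : Preds L) : Sig L → Set where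
    S-Empty : SigOK 𝒫 []
    S-Kind  : ∀ {Σ' a K} → KindOK 𝒫 Σ' [] K → ¬ (a ∈ dom Σ') →
              SigOK 𝒫 (famDecl a K ∷ Σ')
    S-Type  : ∀ {Σ' c σ} → FamOK 𝒫 Σ' [] σ Type → ¬ (c ∈ dom Σ') →
              SigOK 𝒫 (objDecl c σ ∷ Σ')

  data CtxOK {L : Set} (𝒫 : Preds L) (Σ' : Sig L) : Ctx L → Set where
    C-Empty : SigOK 𝒫 Σ' → CtxOK 𝒫 Σ' []
    C-Type  : ∀ {Γ σ} → FamOK 𝒫 Σ' Γ σ Type → CtxOK 𝒫 Σ' (σ ∷ Γ)

  data KindOK {L : Set} (𝒫 : Preds L) (Σ' : Sig L) : Ctx L → Kind L → Set where
    K-Type : ∀ {Γ} → CtxOK 𝒫 Σ' Γ → KindOK 𝒫 Σ' Γ Type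
    K-Pi   : ∀ {Γ σ K} → KindOK 𝒫 Σ' (σ ∷ Γ) K → KindOK 𝒫 Σ' Γ (ΠK σ K)

  data FamOK {L : Set} (𝒫 : Preds L) (Σ' : Sig L) : Ctx L → Fam L → Kind L → Set where
    F-Const : ∀ {Γ a K} → CtxOK 𝒫 Σ' Γ → famDecl a K ∈ Σ' →
              FamOK 𝒫 Σ' Γ (fconst a) K
    F-Pi    : ∀ {Γ σ τ} → FamOK 𝒫 Σ' (σ ∷ Γ) τ Type →
              FamOK 𝒫 Σ' Γ (Πf σ τ) Type
    F-App   : ∀ {Γ σ τ K N} → FamOK 𝒫 Σ' Γ σ (ΠK τ K) → ObjOK 𝒫 Σ' Γ N τ →
              FamOK 𝒫 Σ' Γ (fapp σ N) (K [ N ]K)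
    F-Lock  : ∀ {Γ p N σ ρ} → FamOK 𝒫 Σ' Γ ρ Type → ObjOK 𝒫 Σ' Γ N σ →
              FamOK 𝒫 Σ' Γ (lockF p N σ ρ) Type
    F-Conv  : ∀ {Γ σ K K'} → FamOK 𝒫 Σ' Γ σ K → KindOK 𝒫 Σ' Γ K' → K =K K' →
              FamOK 𝒫 Σ' Γ σ K'
    F-Guarded-Unlock :
              ∀ {Γ p S S' σ σ' ρ τ N} →
              FamOK 𝒫 Σ' (τ ∷ Γ) (lockF p (shiftO S) (shiftF σ) ρ) Type →
              ObjOK 𝒫 Σ' Γ N (lockF p S' σ' τ) →
              σ =F σ' → S =O S' →
              FamOK 𝒫 Σ' Γ (lockF p S σ (ρ [ unlock p S' σ' N ]F)) Type

  data ObjOK {L : Set} (𝒫 : Preds L) (Σ' : Sig L) : Ctx L → Obj L → Fam L → Set where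
    O-Const : ∀ {Γ c σ} → CtxOK 𝒫 Σ' Γ → objDecl c σ ∈ Σ' →
              ObjOK 𝒫 Σ' Γ (oconst c) σ
    O-Var   : ∀ {Γ x σ} → CtxOK 𝒫 Σ' Γ → Γ ∋ x ∶ σ →
              ObjOK 𝒫 Σ' Γ (var x) σ
    O-Abs   : ∀ {Γ σ τ M} → ObjOK 𝒫 Σ' (σ ∷ Γ) M τ →
              ObjOK 𝒫 Σ' Γ (lam σ M) (Πf σ τ)
    O-App   : ∀ {Γ σ τ M N} → ObjOK 𝒫 Σ' Γ M (Πf σ τ) → ObjOK 𝒫 Σ' Γ N σ →
              ObjOK 𝒫 Σ' Γ (oapp M N) (τ [ N ]F)
    O-Conv  : ∀ {Γ M σ τ} → ObjOK 𝒫 Σ' Γ M σ → FamOK 𝒫 Σ' Γ τ Type → σ =F τ →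
              ObjOK 𝒫 Σ' Γ M τ
    O-Lock  : ∀ {Γ p M N σ ρ} → ObjOK 𝒫 Σ' Γ M ρ → ObjOK 𝒫 Σ' Γ N σ →
              ObjOK 𝒫 Σ' Γ (lockO p N σ M) (lockF p N σ ρ)
    O-Top-Unlock :
              ∀ {Γ p M N σ ρ} → ObjOK 𝒫 Σ' Γ M (lockF p N σ ρ) → 𝒫 p Σ' Γ N σ →
              ObjOK 𝒫 Σ' Γ (unlock p N σ M) ρ
    O-Guarded-Unlock :
              ∀ {Γ p S S' σ σ' ρ τ M N} →
              ObjOK 𝒫 Σ' (τ ∷ Γ) (lockO p (shiftO S) (shiftF σ) M)
                                 (lockF p (shiftO S) (shiftF σ) ρ) →
              ObjOK 𝒫 Σ' Γ N (lockF p S' σ' τ) →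
              σ =F σ' → S =O S' →
              ObjOK 𝒫 Σ' Γ (lockO p S σ (M [ unlock p S' σ' N ]O))
                           (lockF p S σ (ρ [ unlock p S' σ' N ]F))

module Submission where

-- The only typing rule whose conclusion has an unlock
-- 𝓤^p_{N,σ}[M] as its subject is (O-Top-Unlock), and that rule demands
-- 𝒫_p(Γ ⊢_Σ N : σ) as a premise; every other rule either builds a
-- differently shaped object or is the conversion rule (O-Conv), which
-- keeps the subject and the context unchanged.  So a derivation of
-- Γ ⊢_Σ 𝓤^p_{N,σ}[M] : τ is a chain of conversions ending in
-- (O-Top-Unlock), from which the predicate can be read off.

open import Data.Unit using (⊤; tt)
open import Defs

UnlockGuard : {L : Set} → Preds L → Sig L → Ctx L → Obj L → Set
UnlockGuard 𝒫 Σ' Γ (unlock p N σ M) = 𝒫 p Σ' Γ N σ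
UnlockGuard 𝒫 Σ' Γ _                = ⊤

-- Every typable object meets its unlock guard: conversion preserves the
-- subject, and (O-Top-Unlock) is the unique rule concluding an unlock.
typable⇒unlockGuard : {L : Set} {𝒫 : Preds L} {Σ' : Sig L} {Γ : Ctx L}
                      {X : Obj L} {τ : Fam L} →
                      ObjOK 𝒫 Σ' Γ X τ → UnlockGuard 𝒫 Σ' Γ X
typable⇒unlockGuard (O-Conv d _ _)             = typable⇒unlockGuard d
typable⇒unlockGuard (O-Top-Unlock _ guard)     = guard
typable⇒unlockGuard (O-Const _ _)              = tt
typable⇒unlockGuard (O-Var _ _)                = tt
typable⇒unlockGuard (O-Abs _)                  = tt
typable⇒unlockGuard (O-App _ _)                = tt
typable⇒unlockGuard (O-Lock _ _)               = tt
typable⇒unlockGuard (O-Guarded-Unlock _ _ _ _) = tt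

theorem4p7 : (L : Set) (𝒫 : Preds L) (Σ' : Sig L) (Γ : Ctx L)
             (p : L) (N : Obj L) (σ : Fam L) (M : Obj L) (τ : Fam L) →
             ObjOK 𝒫 Σ' Γ (unlock p N σ M) τ →
             𝒫 p Σ' Γ N σ
theorem4p7 L 𝒫 Σ' Γ p N σ M τ d = typable⇒unlockGuard d
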